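{- The $a$-degree of the empty function $\lambda$ is the least $a$-degree, i.e. $\lambda\le_a\varphi$ for every partial function $\varphi$ on $\omega$. Moreover, a partial function $\varphi$ belongs to the $a$-degree of $\lambda$ if and only if $\varphi$ is partial computable and $\mathrm{dom}(\varphi)$ is computable.
   Context: For partial functions $\varphi,\psi:\omega\to\omega$, $\varphi\le_m\psi$ if there is a total computable $g$ with $\varphi=\psi\circ g$ (including $\varphi(x)\downarrow\iff\psi(g(x))\downarrow$ for all $x$). The join $\varphi\oplus\psi$ is given by $(\varphi\oplus\psi)(2x)=\varphi(x)$, $(\varphi\oplus\psi)(2x+1)=\psi(x)$. Let $\iota$ be the partial function with $\iota(0)$ undefined and $\iota(x+1)=x$. Then $\varphi\le_a\psi$ (augmented $m$-reducibility) if $\varphi\le_m(\iota\oplus\psi)$; $a$-degrees are the equivalence classes of $\le_a$-equivalence. $\lambda$ is the nowhere-defined function. -}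

module Defs where

open import Data.Nat using (ℕ; zero; suc; _+_; _*_; _<_)
open import Data.Fin using (Fin)
open import Data.Vec using (Vec; []; _∷_; lookup)
open import Data.Product using (Σ; ∃; _×_; _,_)
open import Data.Sum using (_⊎_)
open import Data.Empty using (⊥)
open import Relation.Binary.PropositionalEquality using (_≡_)
open import Function.Bundles using (_⇔_)

data PR : ℕ → Set where
  Z    : ∀ {n} → PR n
  S    : PR 1
  P    : ∀ {n} → Fin n → PR n
  comp : ∀ {m n} → PR m → Vec (PR n) m → PR n
  prec : ∀ {n} → PR n → PR (suc (suc n)) → PR (suc n)
  mu   : ∀ {n} → PR (suc n) → PR n

mutual
  data Eval : ∀ {n} → PR n → Vec ℕ n → ℕ → Set where
    eZ    : ∀ {n} {xs : Vec ℕ n} → Eval Z xs 0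
    eS    : ∀ {x} → Eval S (x ∷ []) (suc x)
    eP    : ∀ {n} {i : Fin n} {xs : Vec ℕ n} → Eval (P i) xs (lookup xs i)
    eComp : ∀ {m n} {f : PR m} {gs : Vec (PR n) m} {xs : Vec ℕ n} {ys : Vec ℕ m} {y : ℕ} →
            EvalVec gs xs ys → Eval f ys y → Eval (comp f gs) xs y
    ePrec0 : ∀ {n} {g : PR n} {h : PR (suc (suc n))} {xs : Vec ℕ n} {y : ℕ} →
             Eval g xs y → Eval (prec g h) (0 ∷ xs) y
    ePrecS : ∀ {n} {g : PR n} {h : PR (suc (suc n))} {xs : Vec ℕ n} {k r y : ℕ} →
             Eval (prec g h) (k ∷ xs) r → Eval h (k ∷ r ∷ xs) y →
             Eval (prec g h) (suc k ∷ xs) y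
    eMu   : ∀ {n} {f : PR (suc n)} {xs : Vec ℕ n} {y : ℕ} →
            Eval f (y ∷ xs) 0 →
            (∀ z → z < y → Σ ℕ λ k → Eval f (z ∷ xs) (suc k)) →
            Eval (mu f) xs y

  data EvalVec : ∀ {m n} → Vec (PR n) m → Vec ℕ n → Vec ℕ m → Set where
    []ᵉ  : ∀ {n} {xs : Vec ℕ n} → EvalVec [] xs []
    _∷ᵉ_ : ∀ {m n} {g : PR n} {gs : Vec (PR n) m} {xs : Vec ℕ n} {y : ℕ} {ys : Vec ℕ m} →
           Eval g xs y → EvalVec gs xs ys → EvalVec (g ∷ gs) xs (y ∷ ys)

record PartialFn : Set₁ where
  field
    graph  : ℕ → ℕ → Set
    single : ∀ {x y z} → graph x y → graph x z → y ≡ z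
open PartialFn public

dom : PartialFn → ℕ → Set
dom φ x = Σ ℕ λ y → graph φ x y

TotalComputable : (ℕ → ℕ) → Set
TotalComputable g = Σ (PR 1) λ e → ∀ x → Eval e (x ∷ []) (g x)

PartialComputable : PartialFn → Set
PartialComputable φ = Σ (PR 1) λ e → ∀ x y → graph φ x y ⇔ Eval e (x ∷ []) y

ComputableSet : (ℕ → Set) → Set
ComputableSet A = Σ (ℕ → ℕ) λ χ → TotalComputable χ × (∀ x → (A x ⇔ χ x ≡ 1)) × (∀ x → χ x ≡ 0 ⊎ χ x ≡ 1)

_≤m_ : PartialFn → PartialFn → Set
φ ≤m ψ = Σ (ℕ → ℕ) λ g → TotalComputable g × (∀ x y → graph φ x y ⇔ graph ψ (g x) y)

private
  join-graph : PartialFn → PartialFn → ℕ → ℕ → Set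
  join-graph φ ψ n y = (Σ ℕ λ x → n ≡ 2 * x × graph φ x y)
                     ⊎ (Σ ℕ λ x → n ≡ 2 * x + 1 × graph ψ x y)

open import Data.Nat.Properties using (*-cancelˡ-≡; m≢1+m+n)
open import Data.Sum using (inj₁; inj₂)
open import Relation.Binary.PropositionalEquality using (refl; sym; trans; subst; cong)
open import Data.Nat.Properties using (+-comm)
open import Data.Empty using (⊥-elim)

private
  even≢odd : ∀ a b → 2 * a ≡ 2 * b + 1 → ⊥
  even≢odd zero zero ()
  even≢odd zero (suc b) ()
  even≢odd (suc a) zero p with trans (sym (Data.Nat.Properties.+-suc (suc a) (a + 0))) p
  ... | ()
  even≢odd (suc a) (suc b) p =
    even≢odd a b (Data.Nat.Properties.suc-injective (Data.Nat.Properties.suc-injective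
      (trans (trans (cong suc (sym (Data.Nat.Properties.+-suc a (a + 0)))) p)
             (cong suc (cong (_+ 1) (Data.Nat.Properties.+-suc b (b + 0)))))))

  2*-inj : ∀ a b → 2 * a ≡ 2 * b → a ≡ b
  2*-inj a b p = *-cancelˡ-≡ a b 2 p

  odd-inj : ∀ a b → 2 * a + 1 ≡ 2 * b + 1 → a ≡ b
  odd-inj a b p = 2*-inj a b (Data.Nat.Properties.+-cancelʳ-≡ 1 (2 * a) (2 * b) p)

  join-single : ∀ φ ψ {n y z} → join-graph φ ψ n y → join-graph φ ψ n z → y ≡ z
  join-single φ ψ (inj₁ (a , p , u)) (inj₁ (b , q , v)) =
    single φ u (subst (λ c → graph φ c _) (sym (2*-inj a b (trans (sym p) q))) v)
  join-single φ ψ (inj₁ (a , p , u)) (inj₂ (b , q , v)) = ⊥-elim (even≢odd a b (trans (sym p) q))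
  join-single φ ψ (inj₂ (a , p , u)) (inj₁ (b , q , v)) = ⊥-elim (even≢odd b a (trans (sym q) p))
  join-single φ ψ (inj₂ (a , p , u)) (inj₂ (b , q , v)) =
    single ψ u (subst (λ c → graph ψ c _) (sym (odd-inj a b (trans (sym p) q))) v)

_⊕_ : PartialFn → PartialFn → PartialFn
φ ⊕ ψ = record { graph = join-graph φ ψ ; single = join-single φ ψ }

ι : PartialFn
ι = record { graph = λ x y → x ≡ suc y
           ; single = λ p q → Data.Nat.Properties.suc-injective (trans (sym p) q) }

λ∅ : PartialFn
λ∅ = record { graph = λ _ _ → ⊥ ; single = λ () }

_≤a_ : PartialFn → PartialFn → Set
φ ≤a ψ = φ ≤m (ι ⊕ ψ)

_≡a_ : PartialFn → PartialFn → Set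
φ ≡a ψ = (φ ≤a ψ) × (ψ ≤a φ)

-- φ ≤a λ∅ says exactly that φ ≤m ι ⊕ λ∅, and ι ⊕ λ∅ is the partial computable function
-- 2(y+1) ↦ y, whose domain (the positive evens) is computable; both properties pass down
-- along m-reductions.  Conversely, if φ is partial computable with computable domain, then
-- x ↦ 2(φ(x)+1) on dom φ and x ↦ 0 off it is a total computable m-reduction to ι ⊕ λ∅.
-- Finally λ∅ ≤a φ via the constant 0, because ι ⊕ φ is undefined at 0.
module Submission where

open import Defs

open import Data.Empty using (⊥-elim)
open import Data.Fin using (#_)
open import Data.Nat using (ℕ; zero; suc; pred; _+_; _*_; _∸_; _<_; ∣_-_∣)
open import Data.Nat.Properties
  using (<-cmp; <⇒≢; 0≢1+n; suc-injective; +-identityʳ; +-suc; +-comm; pred[m∸n]≡m∸[1+n];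
         m≡n⇒∣m-n∣≡0; ∣m-n∣≡0⇒m≡n)
open import Data.Product using (Σ; _×_; _,_; proj₁; proj₂; map; map₂)
open import Data.Sum using (_⊎_; inj₁; inj₂)
open import Data.Vec using (Vec; []; _∷_)
open import Function.Base using (_∘_)
open import Function.Bundles using (_⇔_; mk⇔; Equivalence)
open import Function.Properties.Equivalence using () renaming (sym to ⇔-sym; trans to ⇔-trans)
open import Relation.Binary.Definitions using (tri<; tri≈; tri>)
open import Relation.Binary.PropositionalEquality
  using (_≡_; _≢_; refl; sym; trans; cong; cong₂; subst)
open import Relation.Nullary using (¬_)

open Equivalence using (to; from)

mutual
  Eval-functional : ∀ {n} {f : PR n} {xs : Vec ℕ n} {y z} → Eval f xs y → Eval f xs z → y ≡ z
  Eval-functional eZ eZ = refl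
  Eval-functional eS eS = refl
  Eval-functional eP eP = refl
  Eval-functional (eComp us d) (eComp vs d') with EvalVec-functional us vs
  ... | refl = Eval-functional d d'
  Eval-functional (ePrec0 d) (ePrec0 d') = Eval-functional d d'
  Eval-functional (ePrecS d e) (ePrecS d' e') with Eval-functional d d'
  ... | refl = Eval-functional e e'
  Eval-functional (eMu {y = y} zero-at-y pos-below-y) (eMu {y = y'} zero-at-y' pos-below-y')
    with <-cmp y y'
  ... | tri≈ _ y≡y' _ = y≡y'
  ... | tri< y<y' _ _ = ⊥-elim (0≢1+n (Eval-functional zero-at-y (proj₂ (pos-below-y' y y<y'))))
  ... | tri> _ _ y>y' = ⊥-elim (0≢1+n (Eval-functional zero-at-y' (proj₂ (pos-below-y y' y>y'))))

  EvalVec-functional : ∀ {m n} {gs : Vec (PR n) m} {xs ys zs} →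
                       EvalVec gs xs ys → EvalVec gs xs zs → ys ≡ zs
  EvalVec-functional []ᵉ []ᵉ = refl
  EvalVec-functional (d ∷ᵉ ds) (d' ∷ᵉ ds') = cong₂ _∷_ (Eval-functional d d') (EvalVec-functional ds ds')

Eval-mu⇔ : ∀ {n} {f : PR (suc n)} {xs : Vec ℕ n} {d : ℕ → ℕ} →
           (∀ y → Eval f (y ∷ xs) (d y)) →
           ∀ y → Eval (mu f) xs y ⇔ (d y ≡ 0 × (∀ z → z < y → d z ≢ 0))
Eval-mu⇔ {f = f} {xs} {d} f-eval y = mk⇔ least-zero search
  where
  least-zero : Eval (mu f) xs y → d y ≡ 0 × (∀ z → z < y → d z ≢ 0)
  least-zero (eMu zero-at-y pos-below-y) =
    Eval-functional (f-eval y) zero-at-y ,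
    λ z z<y dz≡0 → 0≢1+n (trans (sym dz≡0) (Eval-functional (f-eval z) (proj₂ (pos-below-y z z<y))))

  as-suc : ∀ m → m ≢ 0 → Σ ℕ λ k → m ≡ suc k
  as-suc zero    m≢0 = ⊥-elim (m≢0 refl)
  as-suc (suc k) _   = k , refl

  search : d y ≡ 0 × (∀ z → z < y → d z ≢ 0) → Eval (mu f) xs y
  search (dy≡0 , nonzero-below) =
    eMu (subst (Eval f (y ∷ xs)) dy≡0 (f-eval y))
        λ z z<y → map₂ (λ dz≡1+k → subst (Eval f (z ∷ xs)) dz≡1+k (f-eval z))
                       (as-suc (d z) (nonzero-below z z<y))

eComp₁ : ∀ {n} {f : PR 1} {g : PR n} {xs y z} →
         Eval g xs y → Eval f (y ∷ []) z → Eval (comp f (g ∷ [])) xs z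
eComp₁ d e = eComp (d ∷ᵉ []ᵉ) e

eComp₂ : ∀ {n} {f : PR 2} {g h : PR n} {xs y y' z} →
         Eval g xs y → Eval h xs y' → Eval f (y ∷ y' ∷ []) z → Eval (comp f (g ∷ h ∷ [])) xs z
eComp₂ d d' e = eComp (d ∷ᵉ (d' ∷ᵉ []ᵉ)) e

oneᴾ : ∀ {n} → PR n
oneᴾ = comp S (Z ∷ [])

oneᴾ-eval : ∀ {n} {xs : Vec ℕ n} → Eval oneᴾ xs 1
oneᴾ-eval = eComp₁ eZ eS

predᴾ : PR 1
predᴾ = prec Z (P (# 0))

predᴾ-eval : ∀ n → Eval predᴾ (n ∷ []) (pred n)
predᴾ-eval zero    = ePrec0 eZ
predᴾ-eval (suc n) = ePrecS (predᴾ-eval n) eP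

-- The subtrahend comes first, because prec recurses on the first argument.
monusᴾ : PR 2
monusᴾ = prec (P (# 0)) (comp predᴾ (P (# 1) ∷ []))

monusᴾ-eval : ∀ n m → Eval monusᴾ (n ∷ m ∷ []) (m ∸ n)
monusᴾ-eval zero    m = ePrec0 eP
monusᴾ-eval (suc n) m = subst (Eval monusᴾ (suc n ∷ m ∷ [])) (pred[m∸n]≡m∸[1+n] m n)
  (ePrecS (monusᴾ-eval n m) (eComp₁ eP (predᴾ-eval (m ∸ n))))

plusᴾ : PR 2
plusᴾ = prec (P (# 0)) (comp S (P (# 1) ∷ []))

plusᴾ-eval : ∀ m n → Eval plusᴾ (m ∷ n ∷ []) (m + n)
plusᴾ-eval zero    n = ePrec0 eP
plusᴾ-eval (suc m) n = ePrecS (plusᴾ-eval m n) (eComp₁ eP eS)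

∣m-n∣≡m∸n+n∸m : ∀ m n → ∣ m - n ∣ ≡ (m ∸ n) + (n ∸ m)
∣m-n∣≡m∸n+n∸m zero    zero    = refl
∣m-n∣≡m∸n+n∸m zero    (suc n) = refl
∣m-n∣≡m∸n+n∸m (suc m) zero    = sym (+-identityʳ (suc m))
∣m-n∣≡m∸n+n∸m (suc m) (suc n) = ∣m-n∣≡m∸n+n∸m m n

∣-∣ᴾ : PR 2
∣-∣ᴾ = comp plusᴾ (comp monusᴾ (P (# 1) ∷ P (# 0) ∷ []) ∷ comp monusᴾ (P (# 0) ∷ P (# 1) ∷ []) ∷ [])

∣-∣ᴾ-eval : ∀ m n → Eval ∣-∣ᴾ (m ∷ n ∷ []) ∣ m - n ∣
∣-∣ᴾ-eval m n = subst (Eval ∣-∣ᴾ (m ∷ n ∷ [])) (sym (∣m-n∣≡m∸n+n∸m m n))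
  (eComp₂ (eComp₂ eP eP (monusᴾ-eval n m)) (eComp₂ eP eP (monusᴾ-eval m n)) (plusᴾ-eval _ _))

double : ℕ → ℕ
double zero    = zero
double (suc n) = suc (suc (double n))

double≡2* : ∀ n → double n ≡ 2 * n
double≡2* zero    = refl
double≡2* (suc n) = cong suc (trans (cong suc (double≡2* n)) (sym (+-suc n (n + 0))))

double-injective : ∀ {m n} → double m ≡ double n → m ≡ n
double-injective {zero}  {zero}  _  = refl
double-injective {suc m} {suc n} eq = cong suc (double-injective (suc-injective (suc-injective eq)))

doubleᴾ : PR 1
doubleᴾ = prec Z (comp S (comp S (P (# 1) ∷ []) ∷ []))

doubleᴾ-eval : ∀ n → Eval doubleᴾ (n ∷ []) (double n)
doubleᴾ-eval zero    = ePrec0 eZ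
doubleᴾ-eval (suc n) = ePrecS (doubleᴾ-eval n) (eComp₁ (eComp₁ eP eS) eS)

double∘sucᴾ : PR 1
double∘sucᴾ = comp doubleᴾ (S ∷ [])

double∘sucᴾ-eval : ∀ n → Eval double∘sucᴾ (n ∷ []) (double (suc n))
double∘sucᴾ-eval n = eComp₁ eS (doubleᴾ-eval (suc n))

isOdd : ℕ → ℕ
isOdd zero    = 0
isOdd (suc n) = 1 ∸ isOdd n

isOdd-binary : ∀ n → isOdd n ≡ 0 ⊎ isOdd n ≡ 1
isOdd-binary zero = inj₁ refl
isOdd-binary (suc n) with isOdd n | isOdd-binary n
... | _ | inj₁ refl = inj₂ refl
... | _ | inj₂ refl = inj₁ refl

isOdd-double : ∀ n → isOdd (double n) ≡ 0
isOdd-double zero    = refl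
isOdd-double (suc n) rewrite isOdd-double n = refl

isOdd≡1⇒ : ∀ n → isOdd n ≡ 1 → Σ ℕ λ m → n ≡ suc (double m)
isOdd≡1⇒ (suc zero)    _ = 0 , refl
isOdd≡1⇒ (suc (suc n)) odd with isOdd n | isOdd-binary n | isOdd≡1⇒ n
isOdd≡1⇒ (suc (suc n)) () | _ | inj₁ refl | _
... | _ | inj₂ refl | n-odd = map suc (cong (suc ∘ suc)) (n-odd refl)

isOddᴾ : PR 1
isOddᴾ = prec Z (comp monusᴾ (P (# 1) ∷ oneᴾ ∷ []))

isOddᴾ-eval : ∀ n → Eval isOddᴾ (n ∷ []) (isOdd n)
isOddᴾ-eval zero    = ePrec0 eZ
isOddᴾ-eval (suc n) = ePrecS (isOddᴾ-eval n) (eComp₂ eP oneᴾ-eval (monusᴾ-eval _ 1))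

isPositiveEven : ℕ → ℕ
isPositiveEven zero    = 0
isPositiveEven (suc n) = isOdd n

isPositiveEven≡1⇔ : ∀ n → isPositiveEven n ≡ 1 ⇔ Σ ℕ λ m → n ≡ double (suc m)
isPositiveEven≡1⇔ zero    = mk⇔ (λ ()) λ ()
isPositiveEven≡1⇔ (suc n) =
  mk⇔ (map₂ (cong suc) ∘ isOdd≡1⇒ n) λ { (m , refl) → cong (1 ∸_) (isOdd-double m) }

isPositiveEvenᴾ : PR 1
isPositiveEvenᴾ = prec Z (comp isOddᴾ (P (# 0) ∷ []))

isPositiveEvenᴾ-eval : ∀ n → Eval isPositiveEvenᴾ (n ∷ []) (isPositiveEven n)
isPositiveEvenᴾ-eval zero    = ePrec0 eZ
isPositiveEvenᴾ-eval (suc n) = ePrecS (isPositiveEvenᴾ-eval n) (eComp₁ eP (isOddᴾ-eval n))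

ι⊕-undefined-at-0 : ∀ ψ {y} → ¬ graph (ι ⊕ ψ) 0 y
ι⊕-undefined-at-0 ψ (inj₁ (zero , _ , ()))
ι⊕-undefined-at-0 ψ (inj₂ (x , 0≡2x+1 , _)) = 0≢1+n (trans 0≡2x+1 (+-comm (2 * x) 1))

graph-ι⊕λ∅⇔ : ∀ n y → graph (ι ⊕ λ∅) n y ⇔ n ≡ double (suc y)
graph-ι⊕λ∅⇔ n y = mk⇔ to-double λ n≡ → inj₁ (suc y , trans n≡ (double≡2* (suc y)) , refl)
  where
  to-double : graph (ι ⊕ λ∅) n y → n ≡ double (suc y)
  to-double (inj₁ (_ , n≡2x , refl)) = trans n≡2x (sym (double≡2* (suc y)))

ι⊕λ∅-partialComputable : PartialComputable (ι ⊕ λ∅)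
ι⊕λ∅-partialComputable = mu searchᴾ , λ n y →
  ⇔-trans (graph-ι⊕λ∅⇔ n y) (⇔-trans (least-distance⇔ n y) (⇔-sym (Eval-mu⇔ (searchᴾ-eval n) y)))
  where
  searchᴾ : PR 2
  searchᴾ = comp ∣-∣ᴾ (P (# 1) ∷ comp double∘sucᴾ (P (# 0) ∷ []) ∷ [])

  searchᴾ-eval : ∀ n y → Eval searchᴾ (y ∷ n ∷ []) ∣ n - double (suc y) ∣
  searchᴾ-eval n y = eComp₂ eP (eComp₁ eP (double∘sucᴾ-eval y)) (∣-∣ᴾ-eval n _)

  least-distance⇔ : ∀ n y → n ≡ double (suc y) ⇔
                    (∣ n - double (suc y) ∣ ≡ 0 × (∀ z → z < y → ∣ n - double (suc z) ∣ ≢ 0))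
  least-distance⇔ n y = mk⇔
    (λ n≡ → m≡n⇒∣m-n∣≡0 n≡ ,
            λ z z<y d≡0 → <⇒≢ z<y (suc-injective (double-injective (trans (sym (∣m-n∣≡0⇒m≡n d≡0)) n≡))))
    (∣m-n∣≡0⇒m≡n ∘ proj₁)

ι⊕λ∅-computableDom : ComputableSet (dom (ι ⊕ λ∅))
ι⊕λ∅-computableDom =
  isPositiveEven , (isPositiveEvenᴾ , isPositiveEvenᴾ-eval) ,
  (λ n → ⇔-trans (mk⇔ (map₂ (to (graph-ι⊕λ∅⇔ n _))) (map₂ (from (graph-ι⊕λ∅⇔ n _))))
                 (⇔-sym (isPositiveEven≡1⇔ n))) ,
  isPositiveEven-binary
  where
  isPositiveEven-binary : ∀ n → isPositiveEven n ≡ 0 ⊎ isPositiveEven n ≡ 1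
  isPositiveEven-binary zero    = inj₁ refl
  isPositiveEven-binary (suc n) = isOdd-binary n

TotalComputable-∘ : ∀ {f g : ℕ → ℕ} → TotalComputable f → TotalComputable g → TotalComputable (f ∘ g)
TotalComputable-∘ {g = g} (fᴾ , fᴾ-eval) (gᴾ , gᴾ-eval) =
  comp fᴾ (gᴾ ∷ []) , λ x → eComp₁ (gᴾ-eval x) (fᴾ-eval (g x))

ComputableSet-preimage : ∀ {A B : ℕ → Set} {g : ℕ → ℕ} → TotalComputable g →
                         (∀ x → A x ⇔ B (g x)) → ComputableSet B → ComputableSet A
ComputableSet-preimage {g = g} g-computable A⇔B∘g (χ , χ-computable , B⇔χ≡1 , χ-binary) =
  χ ∘ g , TotalComputable-∘ χ-computable g-computable ,
  (λ x → ⇔-trans (A⇔B∘g x) (B⇔χ≡1 (g x))) , χ-binary ∘ g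

≤m-partialComputable : ∀ {φ ψ} → φ ≤m ψ → PartialComputable ψ → PartialComputable φ
≤m-partialComputable {φ} (g , (gᴾ , gᴾ-eval) , φ⇔ψ∘g) (e , e-correct) =
  comp e (gᴾ ∷ []) , λ x y → mk⇔
    (λ φxy → eComp₁ (gᴾ-eval x) (to (e-correct (g x) y) (to (φ⇔ψ∘g x y) φxy)))
    λ { (eComp (gx ∷ᵉ []ᵉ) run) →
          from (φ⇔ψ∘g x y) (from (e-correct (g x) y)
            (subst (λ v → Eval e (v ∷ []) y) (Eval-functional gx (gᴾ-eval x)) run)) }

≤m-computableDom : ∀ {φ ψ} → φ ≤m ψ → ComputableSet (dom ψ) → ComputableSet (dom φ)
≤m-computableDom (g , g-computable , φ⇔ψ∘g) =
  ComputableSet-preimage g-computable λ x →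
    mk⇔ (λ (y , φxy) → y , to (φ⇔ψ∘g x y) φxy) (λ (y , ψgxy) → y , from (φ⇔ψ∘g x y) ψgxy)

λ∅-≤a : ∀ φ → λ∅ ≤a φ
λ∅-≤a φ = (λ _ → 0) , (Z , λ _ → eZ) , λ x y → mk⇔ (λ ()) (ι⊕-undefined-at-0 φ)

≤m-byProgram : ∀ {φ ψ} (r : PR 1) →
               (∀ x → Σ ℕ λ n → Eval r (x ∷ []) n × (∀ y → graph φ x y ⇔ graph ψ n y)) → φ ≤m ψ
≤m-byProgram r spec =
  (λ x → proj₁ (spec x)) , (r , λ x → proj₁ (proj₂ (spec x))) , λ x → proj₂ (proj₂ (spec x))

computable-≤a-λ∅ : ∀ {φ} → PartialComputable φ → ComputableSet (dom φ) → φ ≤a λ∅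
computable-≤a-λ∅ {φ} (e , e-correct) (χ , (χᴾ , χᴾ-eval) , dom⇔χ≡1 , χ-binary) =
  ≤m-byProgram {φ} {ι ⊕ λ∅} reductionᴾ reduce
  where
  -- Primitive recursion on χ x ∈ {0, 1} is a lazy conditional: e is only run when χ x ≡ 1.
  reductionᴾ : PR 1
  reductionᴾ = comp (prec Z (comp double∘sucᴾ (comp e (P (# 2) ∷ []) ∷ []))) (χᴾ ∷ P (# 0) ∷ [])

  reduce : ∀ x → Σ ℕ λ n → Eval reductionᴾ (x ∷ []) n × (∀ y → graph φ x y ⇔ graph (ι ⊕ λ∅) n y)
  reduce x with χ-binary x
  ... | inj₁ χx≡0 =
    0 , eComp₂ (subst (Eval χᴾ (x ∷ [])) χx≡0 (χᴾ-eval x)) eP (ePrec0 eZ) ,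
    λ y → mk⇔ (λ φxy → ⊥-elim (0≢1+n (trans (sym χx≡0) (to (dom⇔χ≡1 x) (y , φxy)))))
              (⊥-elim ∘ ι⊕-undefined-at-0 λ∅)
  ... | inj₂ χx≡1 with from (dom⇔χ≡1 x) χx≡1
  ... | y₀ , φxy₀ =
    double (suc y₀) ,
    eComp₂ (subst (Eval χᴾ (x ∷ [])) χx≡1 (χᴾ-eval x)) eP
      (ePrecS (ePrec0 eZ) (eComp₁ (eComp₁ eP (to (e-correct x y₀) φxy₀)) (double∘sucᴾ-eval y₀))) ,
    λ y → mk⇔ (λ φxy → from (graph-ι⊕λ∅⇔ _ y) (cong (double ∘ suc) (single φ φxy₀ φxy)))
              (λ j → subst (graph φ x) (suc-injective (double-injective (to (graph-ι⊕λ∅⇔ _ y) j))) φxy₀)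

proposition2p5 : ((φ : PartialFn) → λ∅ ≤a φ)
                 × ((φ : PartialFn) → (φ ≡a λ∅) ⇔ (PartialComputable φ × ComputableSet (dom φ)))
proposition2p5 = λ∅-≤a , λ φ → mk⇔
  (λ (φ≤aλ∅ , _) → ≤m-partialComputable {φ} {ι ⊕ λ∅} φ≤aλ∅ ι⊕λ∅-partialComputable ,
                   ≤m-computableDom {φ} {ι ⊕ λ∅} φ≤aλ∅ ι⊕λ∅-computableDom)
  (λ (φ-computable , dom-computable) → computable-≤a-λ∅ {φ} φ-computable dom-computable , λ∅-≤a φ)
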